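{- For every positive integer $n$ there exists a formula $D$ on variables $x_1,\dots,x_{2n+1}$ such that: $D$ is a complete ternary tree of depth $\lceil\log_2 n\rceil+10$; every non-leaf node of $D$ is a $\mathrm{MAJ}_3$ gate and every leaf of $D$ is a conjunction $x_i\wedge x_j$ of two variables ($i,j\in[2n+1]$); and $D(x)=0$ for every $x\in\{0,1\}^{2n+1}$ with at most $n$ ones.
   Context: $\mathrm{MAJ}_3$ denotes the majority function of three bits. -}

module Defs where

open import Data.Nat using (ℕ; zero; suc; _+_)
import Data.Bool
open import Data.Bool using (Bool; true; false; _∧_; _∨_)
open import Data.Fin using (Fin)
import Data.Fin as Fin

MAJ₃ : Bool → Bool → Bool → Bool
MAJ₃ a b c = (a ∧ b) ∨ (b ∧ c) ∨ (a ∧ c)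

-- A formula on variables indexed by Fin m that is a complete ternary tree
-- of depth d: every internal node is a MAJ₃ gate, every leaf is x_i ∧ x_j.
-- Depth 0 = a single leaf.
data MajAndTree (m : ℕ) : ℕ → Set where
  leaf : Fin m → Fin m → MajAndTree m zero
  maj  : ∀ {d} → MajAndTree m d → MajAndTree m d → MajAndTree m d →
         MajAndTree m (suc d)

eval : ∀ {m d} → MajAndTree m d → (Fin m → Bool) → Bool
eval (leaf i j) x = x i ∧ x j
eval (maj a b c) x = MAJ₃ (eval a x) (eval b x) (eval c x)

bit : Bool → ℕ
bit true = 1
bit false = 0

weight : ∀ m → (Fin m → Bool) → ℕ
weight zero x = 0
weight (suc m) x = bit (x Fin.zero) + weight m (λ i → x (Fin.suc i))

module Submission where

-- Fix m variables and a depth d, and count the formulas of MajAndTree m d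
-- exactly: there are N d of them, and for an input x exactly C d x of them
-- evaluate to true.  A leaf x_i ∧ x_j is true for w² of the m² leaves
-- (w the weight of x), and a MAJ₃ gate is true only if two of its three
-- children are, so C (d+1) ≤ 3 C² N while N (d+1) = N³.  In probabilistic
-- terms the fraction p = C/N obeys p ↦ 3p², so starting from p ≤ 1/4
-- (which holds when 2w ≤ m) it drops below (1/3)(3/4)^(2^d).
--
-- Summing over the 2^m inputs of weight at most n (union bound) and
-- exchanging the order of summation, the number of (formula, light input)
-- pairs on which the formula fires is at most 2^m (3/4)^(2^d) N/3 < N once
-- 4m ≤ 2^d.  Hence some formula fires on no light input at all.

open import Defs
open import Data.Nat using (ℕ; suc; _+_; _*_; _≤_; NonZero)
open import Data.Nat.Logarithm using (⌈log₂_⌉)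
open import Data.Bool using (Bool; false)
open import Data.Fin using (Fin)
open import Data.Product using (Σ)
open import Relation.Binary.PropositionalEquality using (_≡_)

open import Data.Nat using (zero; _<_; _^_; _∸_; z≤n; s≤s; z<s; _≤ᵇ_; ⌈_/2⌉; >-nonZero; >-nonZero⁻¹)
open import Data.Nat.Induction using (<-wellFounded)
open import Data.Nat.Properties
open import Data.Nat.Logarithm.Core using (⌈log2⌉)
open import Data.Nat.Tactic.RingSolver using (solve-∀)
open import Algebra.Properties.CommutativeSemigroup +-commutativeSemigroup using (interchange)
open import Data.Bool using (true; _∧_; T)
open import Data.Fin using () renaming (zero to fzero; suc to fsuc)
open import Data.List using (List; []; _∷_; _++_; map; concatMap; allFin)
open import Data.List.Properties using (map-tabulate)
open import Data.List.Membership.Propositional using (_∈_)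
open import Data.List.Membership.Propositional.Properties using (∈-map⁺; ∈-++⁺ˡ; ∈-++⁺ʳ)
open import Data.List.Relation.Unary.Any using (here; there)
open import Data.Vec using (Vec; []; _∷_; lookup)
import Data.Vec as Vec
open import Data.Vec.Properties using (lookup∘tabulate)
open import Data.Product using (_,_; proj₁; proj₂)
open import Relation.Binary.PropositionalEquality using (refl; sym; trans; cong; cong₂; subst; subst₂; module ≡-Reasoning)
open import Relation.Nullary using (yes; no)
open import Induction.WellFounded using (Acc; acc)

private
  variable
    A B : Set

∑ : List A → (A → ℕ) → ℕ
∑ []       f = 0
∑ (a ∷ as) f = f a + ∑ as f

∑-cong : ∀ (xs : List A) {f g : A → ℕ} → (∀ a → f a ≡ g a) → ∑ xs f ≡ ∑ xs g
∑-cong []       eq = refl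
∑-cong (a ∷ xs) eq = cong₂ _+_ (eq a) (∑-cong xs eq)

∑-mono : ∀ (xs : List A) {f g : A → ℕ} → (∀ a → f a ≤ g a) → ∑ xs f ≤ ∑ xs g
∑-mono []       le = z≤n
∑-mono (a ∷ xs) le = +-mono-≤ (le a) (∑-mono xs le)

∑-zero : ∀ (xs : List A) → ∑ xs (λ _ → 0) ≡ 0
∑-zero []       = refl
∑-zero (a ∷ xs) = ∑-zero xs

∑-+ : ∀ (xs : List A) (f g : A → ℕ) → ∑ xs (λ a → f a + g a) ≡ ∑ xs f + ∑ xs g
∑-+ []       f g = refl
∑-+ (a ∷ xs) f g = trans (cong (f a + g a +_) (∑-+ xs f g)) (interchange (f a) (g a) _ _)

∑-*ˡ : ∀ (xs : List A) k (f : A → ℕ) → ∑ xs (λ a → k * f a) ≡ k * ∑ xs f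
∑-*ˡ []       k f = sym (*-zeroʳ k)
∑-*ˡ (a ∷ xs) k f = trans (cong (k * f a +_) (∑-*ˡ xs k f)) (sym (*-distribˡ-+ k (f a) _))

∑-*ʳ : ∀ (xs : List A) k (f : A → ℕ) → ∑ xs (λ a → f a * k) ≡ ∑ xs f * k
∑-*ʳ []       k f = refl
∑-*ʳ (a ∷ xs) k f = trans (cong (f a * k +_) (∑-*ʳ xs k f)) (sym (*-distribʳ-+ k (f a) _))

∑-++ : ∀ (xs ys : List A) (f : A → ℕ) → ∑ (xs ++ ys) f ≡ ∑ xs f + ∑ ys f
∑-++ []       ys f = refl
∑-++ (a ∷ xs) ys f = trans (cong (f a +_) (∑-++ xs ys f)) (sym (+-assoc (f a) _ _))

∑-map : ∀ (g : A → B) (xs : List A) (f : B → ℕ) → ∑ (map g xs) f ≡ ∑ xs (λ a → f (g a))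
∑-map g []       f = refl
∑-map g (a ∷ xs) f = cong (f (g a) +_) (∑-map g xs f)

∑-concatMap : ∀ (g : A → List B) (xs : List A) (f : B → ℕ) →
  ∑ (concatMap g xs) f ≡ ∑ xs (λ a → ∑ (g a) f)
∑-concatMap g []       f = refl
∑-concatMap g (a ∷ xs) f = trans (∑-++ (g a) _ f) (cong (∑ (g a) f +_) (∑-concatMap g xs f))

∑-swap : ∀ (xs : List A) (ys : List B) (f : A → B → ℕ) →
  ∑ xs (λ a → ∑ ys (f a)) ≡ ∑ ys (λ b → ∑ xs (λ a → f a b))
∑-swap []       ys f = sym (∑-zero ys)
∑-swap (a ∷ xs) ys f = begin
    ∑ ys (f a) + ∑ xs (λ a′ → ∑ ys (f a′))
  ≡⟨ cong (∑ ys (f a) +_) (∑-swap xs ys f) ⟩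
    ∑ ys (f a) + ∑ ys (λ b → ∑ xs (λ a′ → f a′ b))
  ≡⟨ sym (∑-+ ys (f a) _) ⟩
    ∑ ys (λ b → f a b + ∑ xs (λ a′ → f a′ b)) ∎
  where open ≡-Reasoning

∑-product : ∀ (xs : List A) (ys : List B) (f : A → ℕ) (g : B → ℕ) →
  ∑ xs (λ a → ∑ ys (λ b → f a * g b)) ≡ ∑ xs f * ∑ ys g
∑-product xs ys f g =
  trans (∑-cong xs (λ a → ∑-*ˡ ys (f a) g)) (∑-*ʳ xs (∑ ys g) f)

∑-∈ : ∀ {xs : List A} {a} (f : A → ℕ) → a ∈ xs → f a ≤ ∑ xs f
∑-∈ {xs = b ∷ xs} f (here refl) = m≤m+n (f b) _
∑-∈ {xs = b ∷ xs} f (there a∈) = ≤-trans (∑-∈ f a∈) (m≤n+m _ (f b))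

∑-witness : ∀ (xs : List A) (f g : A → ℕ) → ∑ xs f < ∑ xs g → Σ A λ a → f a < g a
∑-witness []       f g ()
∑-witness (a ∷ xs) f g lt with f a <? g a
... | yes fa<ga = a , fa<ga
... | no  fa≮ga = ∑-witness xs f g
  (+-cancelˡ-< (g a) _ _ (≤-<-trans (+-monoˡ-≤ (∑ xs f) (≮⇒≥ fa≮ga)) lt))

∑³ : List A → (A → A → A → ℕ) → ℕ
∑³ xs g = ∑ xs λ a → ∑ xs λ b → ∑ xs λ c → g a b c

∑³-mono : ∀ (xs : List A) {g h : A → A → A → ℕ} →
  (∀ a b c → g a b c ≤ h a b c) → ∑³ xs g ≤ ∑³ xs h
∑³-mono xs le = ∑-mono xs λ a → ∑-mono xs λ b → ∑-mono xs λ c → le a b c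

∑³-+ : ∀ (xs : List A) (g h : A → A → A → ℕ) →
  ∑³ xs (λ a b c → g a b c + h a b c) ≡ ∑³ xs g + ∑³ xs h
∑³-+ xs g h = begin
    ∑³ xs (λ a b c → g a b c + h a b c)
  ≡⟨ ∑-cong xs (λ a → ∑-cong xs (λ b → ∑-+ xs (g a b) (h a b))) ⟩
    ∑ xs (λ a → ∑ xs (λ b → ∑ xs (g a b) + ∑ xs (h a b)))
  ≡⟨ ∑-cong xs (λ a → ∑-+ xs _ _) ⟩
    ∑ xs (λ a → ∑ xs (λ b → ∑ xs (g a b)) + ∑ xs (λ b → ∑ xs (h a b)))
  ≡⟨ ∑-+ xs _ _ ⟩
    ∑³ xs g + ∑³ xs h ∎
  where open ≡-Reasoning

∑³-product : ∀ (xs : List A) (f g h : A → ℕ) →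
  ∑³ xs (λ a b c → f a * g b * h c) ≡ ∑ xs f * ∑ xs g * ∑ xs h
∑³-product xs f g h = begin
    ∑³ xs (λ a b c → f a * g b * h c)
  ≡⟨ ∑-cong xs (λ a → ∑-cong xs (λ b → ∑-*ˡ xs (f a * g b) h)) ⟩
    ∑ xs (λ a → ∑ xs (λ b → f a * g b * H))
  ≡⟨ ∑-cong xs (λ a → ∑-cong xs (λ b → *-assoc (f a) (g b) H)) ⟩
    ∑ xs (λ a → ∑ xs (λ b → f a * (g b * H)))
  ≡⟨ ∑-product xs xs f (λ b → g b * H) ⟩
    ∑ xs f * ∑ xs (λ b → g b * H)
  ≡⟨ cong (∑ xs f *_) (∑-*ʳ xs H g) ⟩
    ∑ xs f * (∑ xs g * H)
  ≡⟨ sym (*-assoc (∑ xs f) _ H) ⟩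
    ∑ xs f * ∑ xs g * H ∎
  where
  open ≡-Reasoning
  H = ∑ xs h

bit-∧ : ∀ p q → bit (p ∧ q) ≡ bit p * bit q
bit-∧ false q     = refl
bit-∧ true  false = refl
bit-∧ true  true  = refl

-- MAJ₃ is true only if some pair of its arguments is; each pair is written
-- as a product of three factors, the missing argument contributing 1.
bit-MAJ₃ : ∀ p q r →
  bit (MAJ₃ p q r) ≤ bit p * bit q * 1 + 1 * bit q * bit r + bit p * 1 * bit r
bit-MAJ₃ false false r     = z≤n
bit-MAJ₃ false true  false = z≤n
bit-MAJ₃ false true  true  = s≤s z≤n
bit-MAJ₃ true  false false = z≤n
bit-MAJ₃ true  false true  = s≤s z≤n
bit-MAJ₃ true  true  r     = s≤s z≤n

weight-ext : ∀ m {x y : Fin m → Bool} → (∀ i → x i ≡ y i) → weight m x ≡ weight m y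
weight-ext zero    eq = refl
weight-ext (suc m) eq = cong₂ _+_ (cong bit (eq fzero)) (weight-ext m (λ i → eq (fsuc i)))

eval-ext : ∀ {m d} (t : MajAndTree m d) {x y : Fin m → Bool} → (∀ i → x i ≡ y i) →
  eval t x ≡ eval t y
eval-ext (leaf i j)  eq = cong₂ _∧_ (eq i) (eq j)
eval-ext (maj a b c) eq
  rewrite eval-ext a eq | eval-ext b eq | eval-ext c eq = refl

inputs : ∀ m → List (Vec Bool m)
inputs zero    = [] ∷ []
inputs (suc m) = map (false ∷_) (inputs m) ++ map (true ∷_) (inputs m)

∈-inputs : ∀ {m} (v : Vec Bool m) → v ∈ inputs m
∈-inputs []          = here refl
∈-inputs (false ∷ v) = ∈-++⁺ˡ (∈-map⁺ (false ∷_) (∈-inputs v))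
∈-inputs (true  ∷ v) = ∈-++⁺ʳ (map (false ∷_) (inputs _)) (∈-map⁺ (true ∷_) (∈-inputs v))

∑-inputs-const : ∀ m k → ∑ (inputs m) (λ _ → k) ≡ k * 2 ^ m
∑-inputs-const zero    k = trans (+-identityʳ k) (sym (*-identityʳ k))
∑-inputs-const (suc m) k = begin
    ∑ (map (false ∷_) vs ++ map (true ∷_) vs) (λ _ → k)
  ≡⟨ ∑-++ (map (false ∷_) vs) _ _ ⟩
    ∑ (map (false ∷_) vs) (λ _ → k) + ∑ (map (true ∷_) vs) (λ _ → k)
  ≡⟨ cong₂ _+_ (∑-map (false ∷_) vs _) (∑-map (true ∷_) vs _) ⟩
    ∑ vs (λ _ → k) + ∑ vs (λ _ → k)
  ≡⟨ cong₂ _+_ (∑-inputs-const m k) (∑-inputs-const m k) ⟩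
    k * 2 ^ m + k * 2 ^ m
  ≡⟨ double k (2 ^ m) ⟩
    k * 2 ^ suc m ∎
  where
  open ≡-Reasoning
  vs = inputs m
  double : ∀ k p → k * p + k * p ≡ k * (2 * p)
  double = solve-∀

∑-allFin-suc : ∀ m (f : Fin (suc m) → ℕ) →
  ∑ (allFin (suc m)) f ≡ f fzero + ∑ (allFin m) (λ i → f (fsuc i))
∑-allFin-suc m f = cong (f fzero +_)
  (trans (cong (λ is → ∑ is f) (sym (map-tabulate (λ i → i) fsuc))) (∑-map fsuc (allFin m) f))

∑-allFin-weight : ∀ m (x : Fin m → Bool) → ∑ (allFin m) (λ i → bit (x i)) ≡ weight m x
∑-allFin-weight zero    x = refl
∑-allFin-weight (suc m) x = trans (∑-allFin-suc m _)
  (cong (bit (x fzero) +_) (∑-allFin-weight m (λ i → x (fsuc i))))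

weight-true : ∀ m → weight m (λ _ → true) ≡ m
weight-true zero    = refl
weight-true (suc m) = cong suc (weight-true m)

∑-allFin-one : ∀ m → ∑ (allFin m) (λ _ → 1) ≡ m
∑-allFin-one m = trans (∑-allFin-weight m (λ _ → true)) (weight-true m)

trees : ∀ m d → List (MajAndTree m d)
trees m zero    = concatMap (λ i → map (leaf i) (allFin m)) (allFin m)
trees m (suc d) = concatMap (λ a → concatMap (λ b → map (maj a b) ts) ts) ts
  where ts = trees m d

∑-trees-zero : ∀ m (f : MajAndTree m zero → ℕ) →
  ∑ (trees m zero) f ≡ ∑ (allFin m) (λ i → ∑ (allFin m) (λ j → f (leaf i j)))
∑-trees-zero m f = trans (∑-concatMap _ (allFin m) f)
  (∑-cong (allFin m) (λ i → ∑-map (leaf i) (allFin m) f))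

∑-trees-suc : ∀ m d (f : MajAndTree m (suc d) → ℕ) →
  ∑ (trees m (suc d)) f ≡ ∑³ (trees m d) (λ a b c → f (maj a b c))
∑-trees-suc m d f = trans (∑-concatMap _ ts f) (∑-cong ts λ a →
  trans (∑-concatMap _ ts f) (∑-cong ts λ b → ∑-map (maj a b) ts f))
  where ts = trees m d

module TreeCounts (m : ℕ) where

  N : ℕ → ℕ
  N d = ∑ (trees m d) (λ _ → 1)

  C : ℕ → (Fin m → Bool) → ℕ
  C d x = ∑ (trees m d) (λ t → bit (eval t x))

  N-zero : N 0 ≡ m * m
  N-zero = trans (∑-trees-zero m _)
    (trans (∑-product (allFin m) (allFin m) _ _) (cong₂ _*_ (∑-allFin-one m) (∑-allFin-one m)))

  C-zero : ∀ x → C 0 x ≡ weight m x * weight m x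
  C-zero x = begin
      ∑ (trees m 0) (λ t → bit (eval t x))
    ≡⟨ ∑-trees-zero m _ ⟩
      ∑ (allFin m) (λ i → ∑ (allFin m) (λ j → bit (x i ∧ x j)))
    ≡⟨ ∑-cong (allFin m) (λ i → ∑-cong (allFin m) (λ j → bit-∧ (x i) (x j))) ⟩
      ∑ (allFin m) (λ i → ∑ (allFin m) (λ j → bit (x i) * bit (x j)))
    ≡⟨ ∑-product (allFin m) (allFin m) _ _ ⟩
      ∑ (allFin m) (λ i → bit (x i)) * ∑ (allFin m) (λ j → bit (x j))
    ≡⟨ cong₂ _*_ (∑-allFin-weight m x) (∑-allFin-weight m x) ⟩
      weight m x * weight m x ∎
    where open ≡-Reasoning

  N-suc : ∀ d → N (suc d) ≡ N d * N d * N d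
  N-suc d = trans (∑-trees-suc m d _) (∑³-product (trees m d) _ _ _)

  -- A gate fires only if two children do: three choices of the pair.
  C-suc : ∀ d x → C (suc d) x ≤ 3 * (C d x * C d x) * N d
  C-suc d x = begin
      C (suc d) x
    ≡⟨ ∑-trees-suc m d _ ⟩
      ∑³ ts (λ a b c → bit (MAJ₃ (eval a x) (eval b x) (eval c x)))
    ≤⟨ ∑³-mono ts (λ a b c → bit-MAJ₃ (eval a x) (eval b x) (eval c x)) ⟩
      ∑³ ts (λ a b c → p a * p b * 1 + 1 * p b * p c + p a * 1 * p c)
    ≡⟨ ∑³-+ ts _ _ ⟩
      ∑³ ts (λ a b c → p a * p b * 1 + 1 * p b * p c) + ∑³ ts (λ a b c → p a * 1 * p c)
    ≡⟨ cong (_+ ∑³ ts (λ a b c → p a * 1 * p c)) (∑³-+ ts _ _) ⟩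
      ∑³ ts (λ a b c → p a * p b * 1) + ∑³ ts (λ a b c → 1 * p b * p c)
        + ∑³ ts (λ a b c → p a * 1 * p c)
    ≡⟨ cong₂ _+_ (cong₂ _+_ (∑³-product ts p p one) (∑³-product ts one p p))
                 (∑³-product ts p one p) ⟩
      C d x * C d x * N d + N d * C d x * C d x + C d x * N d * C d x
    ≡⟨ three-pairs (C d x) (N d) ⟩
      3 * (C d x * C d x) * N d ∎
    where
    open ≤-Reasoning
    ts = trees m d
    p : MajAndTree m d → ℕ
    p t = bit (eval t x)
    one : MajAndTree m d → ℕ
    one _ = 1
    three-pairs : ∀ c n → c * c * n + n * c * c + c * n * c ≡ 3 * (c * c) * n
    three-pairs = solve-∀

  N-pos : .{{_ : NonZero m}} → ∀ d → 0 < N d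
  N-pos zero    = subst (0 <_) (sym N-zero) (product-pos (>-nonZero⁻¹ m) (>-nonZero⁻¹ m))
    where
    product-pos : ∀ {a b} → 0 < a → 0 < b → 0 < a * b
    product-pos {suc a} {suc b} _ _ = z<s
  N-pos (suc d) = subst (0 <_) (sym (N-suc d)) (cube-pos (N-pos d))
    where
    cube-pos : ∀ {a} → 0 < a → 0 < a * a * a
    cube-pos {suc a} _ = z<s

-- Amplification by iterated majority: if the true fraction c/N of trees
-- follows p ↦ 3p² and starts at p ≤ 1/4, then p_d ≤ (1/3)(3/4)^(2^d).
amplify : (c N : ℕ → ℕ) →
  (∀ d → c (suc d) ≤ 3 * (c d * c d) * N d) → (∀ d → N (suc d) ≡ N d * N d * N d) →
  4 * c 0 ≤ N 0 → ∀ d → 3 * 4 ^ (2 ^ d) * c d ≤ 3 ^ (2 ^ d) * N d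
amplify c N c-suc N-suc base zero = begin
    3 * (4 * 1) * c 0
  ≡⟨ reassociate (c 0) ⟩
    3 * 1 * (4 * c 0)
  ≤⟨ *-monoʳ-≤ (3 * 1) base ⟩
    3 * 1 * N 0 ∎
  where
  open ≤-Reasoning
  reassociate : ∀ x → 3 * (4 * 1) * x ≡ 3 * 1 * (4 * x)
  reassociate = solve-∀
amplify c N c-suc N-suc base (suc d) = begin
    3 * 4 ^ (2 * K) * c (suc d)
  ≤⟨ *-monoʳ-≤ (3 * 4 ^ (2 * K)) (c-suc d) ⟩
    3 * 4 ^ (2 * K) * (3 * (c d * c d) * N d)
  ≡⟨ cong (λ q → 3 * q * (3 * (c d * c d) * N d)) (^-double 4 K) ⟩
    3 * (4 ^ K * 4 ^ K) * (3 * (c d * c d) * N d)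
  ≡⟨ square-out (4 ^ K) (c d) (N d) ⟩
    N d * ((3 * 4 ^ K * c d) * (3 * 4 ^ K * c d))
  ≤⟨ *-monoʳ-≤ (N d) (*-mono-≤ ih ih) ⟩
    N d * ((3 ^ K * N d) * (3 ^ K * N d))
  ≡⟨ square-in (3 ^ K) (N d) ⟩
    (3 ^ K * 3 ^ K) * (N d * N d * N d)
  ≡⟨ cong₂ _*_ (sym (^-double 3 K)) (sym (N-suc d)) ⟩
    3 ^ (2 * K) * N (suc d) ∎
  where
  open ≤-Reasoning
  K = 2 ^ d
  ih = amplify c N c-suc N-suc base d
  ^-double : ∀ a k → a ^ (2 * k) ≡ a ^ k * a ^ k
  ^-double a k = trans (^-distribˡ-+-* a k (k + 0)) (cong (λ e → a ^ k * a ^ e) (+-identityʳ k))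
  square-out : ∀ q x n → 3 * (q * q) * (3 * (x * x) * n) ≡ n * ((3 * q * x) * (3 * q * x))
  square-out = solve-∀
  square-in : ∀ p n → n * ((p * n) * (p * n)) ≡ (p * p) * (n * n * n)
  square-in = solve-∀

-- A light input makes a leaf true with probability at most 1/4.
square-bound : ∀ {w n m} → w ≤ n → 2 * n ≤ m → 4 * (w * w) ≤ m * m
square-bound {w} {n} {m} w≤n 2n≤m = begin
    4 * (w * w)
  ≡⟨ as-square w ⟩
    (2 * w) * (2 * w)
  ≤⟨ *-mono-≤ 2w≤m 2w≤m ⟩
    m * m ∎
  where
  open ≤-Reasoning
  2w≤m = ≤-trans (*-monoʳ-≤ 2 w≤n) 2n≤m
  as-square : ∀ w → 4 * (w * w) ≡ (2 * w) * (2 * w)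
  as-square = solve-∀

-- The 2^a inputs are outweighed by the decay (3/4)^K once 4a ≤ K,
-- since 2 · 3⁴ ≤ 4⁴.
union-bound : ∀ a K → a * 4 ≤ K → 2 ^ a * 3 ^ K ≤ 4 ^ K
union-bound a K 4a≤K =
  subst (λ k → 2 ^ a * 3 ^ k ≤ 4 ^ k) (m+[n∸m]≡n 4a≤K) (blocks a (K ∸ a * 4))
  where
  blocks : ∀ a r → 2 ^ a * 3 ^ (a * 4 + r) ≤ 4 ^ (a * 4 + r)
  blocks zero    r = subst (_≤ 4 ^ r) (sym (+-identityʳ (3 ^ r))) (^-monoˡ-≤ r (n≤1+n 3))
  blocks (suc a) r = begin
      2 * 2 ^ a * (3 * (3 * (3 * (3 * 3 ^ e))))
    ≡⟨ collect (2 ^ a) (3 ^ e) ⟩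
      162 * (2 ^ a * 3 ^ e)
    ≤⟨ *-mono-≤ (m≤m+n 162 94) (blocks a r) ⟩
      256 * 4 ^ e
    ≡⟨ spread (4 ^ e) ⟩
      4 * (4 * (4 * (4 * 4 ^ e))) ∎
    where
    open ≤-Reasoning
    e = a * 4 + r
    collect : ∀ p q → 2 * p * (3 * (3 * (3 * (3 * q)))) ≡ 162 * (p * q)
    collect = solve-∀
    spread : ∀ q → 256 * q ≡ 4 * (4 * (4 * (4 * q)))
    spread = solve-∀

n≤2^⌈log₂n⌉ : ∀ n → n ≤ 2 ^ ⌈log₂ n ⌉
n≤2^⌈log₂n⌉ n = bound n (<-wellFounded n)
  where
  bound : ∀ n (rec : Acc _<_ n) → n ≤ 2 ^ ⌈log2⌉ n rec
  bound zero          _        = z≤n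
  bound (suc zero)    _        = s≤s z≤n
  bound (suc (suc k)) (acc rs) = begin
      suc (suc k)
    ≤⟨ s≤s (s≤s k≤c+c) ⟩
      suc (suc (c + c))
    ≡⟨ doubled c ⟩
      2 * suc c
    ≤⟨ *-monoʳ-≤ 2 (bound (suc c) (rs (⌈n/2⌉<n k))) ⟩
      2 * 2 ^ ⌈log2⌉ (suc c) (rs (⌈n/2⌉<n k)) ∎
    where
    open ≤-Reasoning
    c = ⌈ k /2⌉
    k≤c+c : k ≤ c + c
    k≤c+c = subst (_≤ c + c) (⌊n/2⌋+⌈n/2⌉≡n k) (+-monoˡ-≤ c (⌊n/2⌋≤⌈n/2⌉ k))
    doubled : ∀ c → suc (suc (c + c)) ≡ 2 * suc c
    doubled = solve-∀

depth-bound : ∀ n → .{{_ : NonZero n}} → (2 * n + 1) * 4 ≤ 2 ^ (⌈log₂ n ⌉ + 10)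
depth-bound n = begin
    (2 * n + 1) * 4
  ≤⟨ *-monoˡ-≤ 4 (+-monoʳ-≤ (2 * n) (>-nonZero⁻¹ n)) ⟩
    (2 * n + n) * 4
  ≡⟨ twelve n ⟩
    n * 12
  ≤⟨ *-monoʳ-≤ n (m≤m+n 12 1012) ⟩
    n * 1024
  ≤⟨ *-monoˡ-≤ 1024 (n≤2^⌈log₂n⌉ n) ⟩
    2 ^ ⌈log₂ n ⌉ * 2 ^ 10
  ≡⟨ sym (^-distribˡ-+-* 2 ⌈log₂ n ⌉ 10) ⟩
    2 ^ (⌈log₂ n ⌉ + 10) ∎
  where
  open ≤-Reasoning
  twelve : ∀ n → (2 * n + n) * 4 ≡ n * 12
  twelve = solve-∀

∑-gated : ∀ (xs : List A) (b : Bool) (f : A → Bool) k B →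
  (T b → k * ∑ xs (λ a → bit (f a)) ≤ B) → k * ∑ xs (λ a → bit (b ∧ f a)) ≤ B
∑-gated xs false f k B _ = subst (_≤ B) (sym (trans (cong (k *_) (∑-zero xs)) (*-zeroʳ k))) z≤n
∑-gated xs true  f k B open-gate = open-gate _

gated-false : ∀ b e → T b → bit (b ∧ e) < 1 → e ≡ false
gated-false true false _ _         = refl
gated-false true true  _ (s≤s ())

third-below : ∀ s N → 0 < N → 3 * s ≤ N → s < N
third-below zero    N 0<N _    = 0<N
third-below (suc s) N _   3s≤N = <-≤-trans (m<m+n (suc s) z<s) 3s≤N

vanishing-tree : ∀ m n d → .{{_ : NonZero m}} → 2 * n ≤ m → m * 4 ≤ 2 ^ d →
  Σ (MajAndTree m d) λ D → ∀ (x : Fin m → Bool) → weight m x ≤ n → eval D x ≡ false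
vanishing-tree m n d 2n≤m 4m≤K = D , vanishes
  where
  open TreeCounts m
  K = 2 ^ d
  ts = trees m d

  light : Vec Bool m → Bool
  light v = weight m (lookup v) ≤ᵇ n

  misfire : Vec Bool m → MajAndTree m d → ℕ
  misfire v t = bit (light v ∧ eval t (lookup v))

  misfires : MajAndTree m d → ℕ
  misfires t = ∑ (inputs m) (λ v → misfire v t)

  leaf-density : ∀ x → weight m x ≤ n → 4 * C 0 x ≤ N 0
  leaf-density x w≤n = subst₂ _≤_ (cong (4 *_) (sym (C-zero x))) (sym N-zero) (square-bound w≤n 2n≤m)

  per-input : ∀ v → 3 * 4 ^ K * ∑ ts (misfire v) ≤ 3 ^ K * N d
  per-input v = ∑-gated ts (light v) (λ t → eval t (lookup v)) (3 * 4 ^ K) (3 ^ K * N d) λ isLight →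
    amplify (λ e → C e (lookup v)) N (λ e → C-suc e (lookup v)) N-suc
      (leaf-density (lookup v) (≤ᵇ⇒≤ _ n isLight)) d

  total : 4 ^ K * (3 * ∑ ts misfires) ≤ 4 ^ K * N d
  total = begin
      4 ^ K * (3 * ∑ ts misfires)
    ≡⟨ rotate (4 ^ K) _ ⟩
      3 * 4 ^ K * ∑ ts misfires
    ≡⟨ cong (3 * 4 ^ K *_) (∑-swap ts (inputs m) (λ t v → misfire v t)) ⟩
      3 * 4 ^ K * ∑ (inputs m) (λ v → ∑ ts (misfire v))
    ≡⟨ sym (∑-*ˡ (inputs m) (3 * 4 ^ K) _) ⟩
      ∑ (inputs m) (λ v → 3 * 4 ^ K * ∑ ts (misfire v))
    ≤⟨ ∑-mono (inputs m) per-input ⟩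
      ∑ (inputs m) (λ _ → 3 ^ K * N d)
    ≡⟨ ∑-inputs-const m _ ⟩
      3 ^ K * N d * 2 ^ m
    ≡⟨ rearrange (3 ^ K) (N d) (2 ^ m) ⟩
      2 ^ m * 3 ^ K * N d
    ≤⟨ *-monoˡ-≤ (N d) (union-bound m K 4m≤K) ⟩
      4 ^ K * N d ∎
    where
    open ≤-Reasoning
    rotate : ∀ q s → q * (3 * s) ≡ 3 * q * s
    rotate = solve-∀
    rearrange : ∀ a b c → a * b * c ≡ c * a * b
    rearrange = solve-∀

  few-misfires : ∑ ts misfires < ∑ ts (λ _ → 1)
  few-misfires = third-below _ _ (N-pos d) (*-cancelˡ-≤ (4 ^ K) {{m^n≢0 4 K}} total)

  D : MajAndTree m d
  D = proj₁ (∑-witness ts misfires (λ _ → 1) few-misfires)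

  no-misfire : misfires D < 1
  no-misfire = proj₂ (∑-witness ts misfires (λ _ → 1) few-misfires)

  vanishes : ∀ (x : Fin m → Bool) → weight m x ≤ n → eval D x ≡ false
  vanishes x w≤n = trans (eval-ext D x≗v) (gated-false _ _ isLight misfire<1)
    where
    v = Vec.tabulate x
    x≗v : ∀ i → x i ≡ lookup v i
    x≗v i = sym (lookup∘tabulate x i)
    isLight : T (light v)
    isLight = ≤⇒≤ᵇ (subst (_≤ n) (weight-ext m x≗v) w≤n)
    misfire<1 : misfire v D < 1
    misfire<1 = ≤-<-trans (∑-∈ (λ u → misfire u D) (∈-inputs v)) no-misfire

lemma2 : (n : ℕ) → .{{_ : NonZero n}} →
    Σ (MajAndTree (2 * n + 1) (⌈log₂ n ⌉ + 10)) λ D → (∀ (x : Fin (2 * n + 1) → Bool) →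
    weight (2 * n + 1) x ≤ n → eval D x ≡ false)
lemma2 n = vanishing-tree (2 * n + 1) n (⌈log₂ n ⌉ + 10) {{m+1≢0}} (m≤m+n (2 * n) 1) (depth-bound n)
  where
  m+1≢0 : NonZero (2 * n + 1)
  m+1≢0 = >-nonZero (m≤n+m 1 (2 * n))
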